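{- Let $\Pi_1=(\mathcal{A},\mathcal{E},\mathcal{R}_1)$ and $\Pi_2=(\mathcal{A},\mathcal{E},\mathcal{R}_2)$ be ELPs. Then: (1) if $\Pi_1$ and $\Pi_2$ are uniformly CWV-equivalent, then they are uniformly WV-equivalent; (2) there exist ELPs $\Pi_1$ and $\Pi_2$ that are uniformly WV-equivalent but not uniformly CWV-equivalent.
   Context: A (ground) logic program is a pair $(\mathcal{A},\mathcal{R})$ with $\mathcal{A}$ a set of propositional atoms and $\mathcal{R}$ a finite set of rules $a_1\vee\cdots\vee a_l\leftarrow a_{l+1},\dots,a_m,\neg\ell_1,\dots,\neg\ell_n$ ($0\le l\le m$, $n\ge 0$, $a_i\in\mathcal{A}$, each $\ell_i$ an atom $a$ or a default-negated atom $\neg a$; a triple negation $\neg\neg\neg a$ is treated as $\neg a$; an empty head is $\bot$). $H(r)=\{a_1,\dots,a_l\}$, $B(r)=\{a_{l+1},\dots,a_m,\neg\ell_1,\dots,\neg\ell_n\}$, $B^+(r)=\{a_{l+1},\dots,a_m\}$. A fact is a rule $a\leftarrow$. An interpretation is $I\subseteq\mathcal{A}$; $I\models a$ iff $a\in I$, $I\models\neg\ell$ iff $I\not\models\ell$; $I\models r$ iff ($I$ satisfies all of $B(r)$ implies $H(r)\cap I\neq\emptyset$); $I$ is a model of a program if it satisfies all its rules. The GL-reduct $\Pi^I$ has rules $\{H(r)\leftarrow B^+(r)\mid r\in\mathcal{R},\ I\models\neg\ell\text{ for all }\neg\ell\in B(r)\}$. $M\subseteq\mathcal{A}$ is an answer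 set of $\Pi$ if $M$ is a model of $\Pi$ and no $M'\subsetneq M$ is a model of $\Pi^M$; $AS(\Pi)$ denotes the set of answer sets. An epistemic literal is $\mathbf{not}\,\ell$ with $\ell$ a literal. An ELP is a triple $\Pi=(\mathcal{A},\mathcal{E},\mathcal{R})$ with $\mathcal{E}$ a set of epistemic literals over $\mathcal{A}$ and $\mathcal{R}$ a finite set of rules $a_1\vee\cdots\vee a_k\leftarrow\ell_1,\dots,\ell_m,\xi_1,\dots,\xi_j,\neg\xi_{j+1},\dots,\neg\xi_n$ with $\ell_i$ literals and $\xi_i\in\mathcal{E}$. Union: $(\mathcal{A}_1,\mathcal{E}_1,\mathcal{R}_1)\cup(\mathcal{A}_2,\mathcal{E}_2,\mathcal{R}_2)=(\mathcal{A}_1\cup\mathcal{A}_2,\mathcal{E}_1\cup\mathcal{E}_2,\mathcal{R}_1\cup\mathcal{R}_2)$; a set of facts $D\subseteq\mathcal{A}$ is the ELP $(\mathcal{A},\emptyset,\{a\leftarrow\mid a\in D\})$. A guess is $\Phi\subseteq\mathcal{E}$. A set $\mathcal{I}$ of interpretations is $\Phi$-compatible w.r.t. $\mathcal{E}$ iff $\mathcal{I}\neq\emptyset$, for each $\mathbf{not}\,\ell\in\Phi$ some $I\in\mathcal{I}$ has $I\not\models\ell$, and for each $\mathbf{not}\,\ell\in\mathcal{E}\setminus\Phi$ all $I\in\mathcal{I}$ satisfy $I\models\ell$. The epistemic reduct $\Pi^\Phi=(\mathcal{A},\mathcal{R}^\Phi)$ is obtained by replacing each occurrence of $\mathbf{not}\,\ell\in\Phi$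 by $\top$ and every remaining $\mathbf{not}$ by $\neg$. $\mathcal{M}$ is a candidate world view (CWV) of $\Pi$ if for some guess $\Phi\subseteq\mathcal{E}$, $\mathcal{M}=AS(\Pi^\Phi)$ and $\mathcal{M}$ is $\Phi$-compatible w.r.t. $\mathcal{E}$. A CWV is a world view (WV) if its guess $\Phi$ is subset-maximal, i.e. no CWV has an associated guess $\Phi'\supsetneq\Phi$. Two ELPs are CWV-equivalent (resp. WV-equivalent) iff their sets of CWVs (resp. WVs) coincide. $\Pi_1,\Pi_2$ are uniformly CWV-equivalent (resp. uniformly WV-equivalent) iff for every set of facts $D\subseteq\mathcal{A}$, $\Pi_1\cup D$ and $\Pi_2\cup D$ are CWV-equivalent (resp. WV-equivalent). -}

module Defs where

open import Data.Bool using (Bool; true; false; not; if_then_else_)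
open import Data.List using (List; []; _∷_; _++_; map)
open import Data.List.Relation.Unary.All using (All)
open import Data.List.Relation.Unary.Any using (Any)
open import Data.List.Membership.Propositional using (_∈_)
open import Data.Product using (Σ; _×_; ∃; ∃-syntax; _,_)
open import Relation.Binary.PropositionalEquality using (_≡_)
open import Relation.Nullary using (¬_)

-- Throughout, the set of atoms 𝒜 is a type A (the whole type).
-- Interpretations I ⊆ 𝒜 are characteristic functions A → Bool.

Interp : Set → Set
Interp A = A → Bool

data Literal (A : Set) : Set where
  pos : A → Literal A
  neg : A → Literal A

⟦_⟧ˡ : {A : Set} → Literal A → Interp A → Bool
⟦ pos a ⟧ˡ I = I a
⟦ neg a ⟧ˡ I = not (I a)

-- ℓ in a negative body element ¬ℓ :  an atom a, a negated atom ¬a,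
-- or ⊤ (arising from the epistemic reduct, giving ¬⊤).
data NLit (A : Set) : Set where
  atomN : A → NLit A
  negN  : A → NLit A
  topN  : NLit A

⟦_⟧ⁿ : {A : Set} → NLit A → Interp A → Bool
⟦ atomN a ⟧ⁿ I = I a
⟦ negN a ⟧ⁿ I = not (I a)
⟦ topN ⟧ⁿ I = true

record LRule (A : Set) : Set where
  constructor lrule
  field
    headL : List A
    bodyPos : List A
    bodyNeg : List (NLit A)   -- the ℓᵢ of the elements ¬ℓᵢ
open LRule public

LP : Set → Set
LP A = List (LRule A)

True : {A : Set} → Interp A → A → Set
True I a = I a ≡ true

SatNeg : {A : Set} → Interp A → NLit A → Set
SatNeg I ℓ = ⟦ ℓ ⟧ⁿ I ≡ false

_⊨ʳ_ : {A : Set} → Interp A → LRule A → Set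
I ⊨ʳ r = (All (True I) (bodyPos r) × All (SatNeg I) (bodyNeg r))
         → Any (True I) (headL r)

_⊨ᴾ_ : {A : Set} → Interp A → LP A → Set
I ⊨ᴾ P = All (I ⊨ʳ_) P

allFalse : {A : Set} → Interp A → List (NLit A) → Bool
allFalse I [] = true
allFalse I (ℓ ∷ ℓs) = if ⟦ ℓ ⟧ⁿ I then false else allFalse I ℓs

GL : {A : Set} → LP A → Interp A → LP A
GL [] I = []
GL (r ∷ rs) I =
  if allFalse I (bodyNeg r)
  then lrule (headL r) (bodyPos r) [] ∷ GL rs I
  else GL rs I

_⊆ᴵ_ : {A : Set} → Interp A → Interp A → Set
J ⊆ᴵ I = ∀ a → J a ≡ true → I a ≡ true

_⊊ᴵ_ : {A : Set} → Interp A → Interp A → Set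
J ⊊ᴵ I = J ⊆ᴵ I × ∃[ a ] (I a ≡ true × J a ≡ false)

AnswerSet : {A : Set} → LP A → Interp A → Set
AnswerSet P M = M ⊨ᴾ P × (∀ M′ → M′ ⊊ᴵ M → ¬ (M′ ⊨ᴾ GL P M))

-- An epistemic literal  not ℓ  is represented by its literal ℓ.
EpLit : Set → Set
EpLit = Literal

record ERule (A : Set) : Set where
  constructor erule
  field
    headE : List A
    lits : List (Literal A)
    epis : List (EpLit A)
    negEpis : List (EpLit A)    -- ξ_{j+1} … ξ_n  (occurring as ¬ξ)
open ERule public

record ELP (A : Set) : Set where
  constructor elp
  field
    eps : List (EpLit A)
    rules : List (ERule A)
open ELP public

WellFormed : {A : Set} → ELP A → Set
WellFormed Π = All (λ r → All (_∈ eps Π) (epis r) × All (_∈ eps Π) (negEpis r)) (rules Π)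

fact : {A : Set} → A → ERule A
fact a = erule (a ∷ []) [] [] []

_∪ᶠ_ : {A : Set} → ELP A → List A → ELP A
Π ∪ᶠ D = elp (eps Π) (rules Π ++ map fact D)

-- a guess Φ ⊆ ℰ, given by its characteristic function
Guess : Set → Set
Guess A = EpLit A → Bool

GuessIn : {A : Set} → ELP A → Guess A → Set
GuessIn Π Φ = ∀ ξ → Φ ξ ≡ true → ξ ∈ eps Π

_⊊ᴳ_ : {A : Set} → Guess A → Guess A → Set
Φ ⊊ᴳ Φ′ = (∀ ξ → Φ ξ ≡ true → Φ′ ξ ≡ true) × ∃[ ξ ] (Φ′ ξ ≡ true × Φ ξ ≡ false)

posAtoms : {A : Set} → List (Literal A) → List A
posAtoms [] = []
posAtoms (pos a ∷ ls) = a ∷ posAtoms ls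
posAtoms (neg a ∷ ls) = posAtoms ls

negLits : {A : Set} → List (Literal A) → List (NLit A)
negLits [] = []
negLits (pos a ∷ ls) = negLits ls
negLits (neg a ∷ ls) = atomN a ∷ negLits ls

-- not ℓ ↦ ⊤ if in Φ, else ¬ℓ   (ℓ = a gives ¬a, ℓ = ¬a gives ¬¬a)
notToNeg : {A : Set} → EpLit A → NLit A
notToNeg (pos a) = atomN a
notToNeg (neg a) = negN a

epiPart : {A : Set} → Guess A → List (EpLit A) → List (NLit A)
epiPart Φ [] = []
epiPart Φ (ξ ∷ ξs) = if Φ ξ then epiPart Φ ξs else notToNeg ξ ∷ epiPart Φ ξs

-- ¬(not ℓ) ↦ ¬⊤ if in Φ, else ¬¬ℓ   (ℓ = a gives ¬¬a, ℓ = ¬a gives ¬¬¬a = ¬a)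
notNotToNeg : {A : Set} → EpLit A → NLit A
notNotToNeg (pos a) = negN a
notNotToNeg (neg a) = atomN a

negEpiPart : {A : Set} → Guess A → List (EpLit A) → List (NLit A)
negEpiPart Φ [] = []
negEpiPart Φ (ξ ∷ ξs) = (if Φ ξ then topN else notNotToNeg ξ) ∷ negEpiPart Φ ξs

reductRule : {A : Set} → Guess A → ERule A → LRule A
reductRule Φ r =
  lrule (headE r) (posAtoms (lits r))
        (negLits (lits r) ++ epiPart Φ (epis r) ++ negEpiPart Φ (negEpis r))

epReduct : {A : Set} → ELP A → Guess A → LP A
epReduct Π Φ = map (reductRule Φ) (rules Π)

ISet : Set → Set₁
ISet A = Interp A → Set

Compatible : {A : Set} → List (EpLit A) → Guess A → ISet A → Set
Compatible ℰ Φ 𝓘 =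
  (∃[ I ] 𝓘 I)
  × (∀ ξ → ξ ∈ ℰ → Φ ξ ≡ true → ∃[ I ] (𝓘 I × ⟦ ξ ⟧ˡ I ≡ false))
  × (∀ ξ → ξ ∈ ℰ → Φ ξ ≡ false → ∀ I → 𝓘 I → ⟦ ξ ⟧ˡ I ≡ true)

CWVwith : {A : Set} → ELP A → Guess A → ISet A → Set
CWVwith Π Φ 𝓜 =
  GuessIn Π Φ
  × (∀ I → (𝓜 I → AnswerSet (epReduct Π Φ) I) × (AnswerSet (epReduct Π Φ) I → 𝓜 I))
  × Compatible (eps Π) Φ 𝓜

CWV : {A : Set} → ELP A → ISet A → Set
CWV Π 𝓜 = ∃[ Φ ] CWVwith Π Φ 𝓜

WV : {A : Set} → ELP A → ISet A → Set₁
WV Π 𝓜 = ∃[ Φ ] (CWVwith Π Φ 𝓜 × (∀ Φ′ 𝓜′ → CWVwith Π Φ′ 𝓜′ → ¬ (Φ ⊊ᴳ Φ′)))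

CWVEquiv : {A : Set} → ELP A → ELP A → Set₁
CWVEquiv Π₁ Π₂ = ∀ 𝓜 → (CWV Π₁ 𝓜 → CWV Π₂ 𝓜) × (CWV Π₂ 𝓜 → CWV Π₁ 𝓜)

WVEquiv : {A : Set} → ELP A → ELP A → Set₁
WVEquiv Π₁ Π₂ = ∀ 𝓜 → (WV Π₁ 𝓜 → WV Π₂ 𝓜) × (WV Π₂ 𝓜 → WV Π₁ 𝓜)

UniformCWVEquiv : {A : Set} → ELP A → ELP A → Set₁
UniformCWVEquiv Π₁ Π₂ = ∀ (D : List _) → CWVEquiv (Π₁ ∪ᶠ D) (Π₂ ∪ᶠ D)

UniformWVEquiv : {A : Set} → ELP A → ELP A → Set₁
UniformWVEquiv Π₁ Π₂ = ∀ (D : List _) → WVEquiv (Π₁ ∪ᶠ D) (Π₂ ∪ᶠ D)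

-- (1) A candidate world view fixes its guess: ξ ∈ Φ iff some member falsifies ℓ, for
-- ξ = not ℓ.  So two programs over the same ℰ with the same candidate world views attach
-- the same guesses to them, hence have the same subset-maximal ones.
-- (2) Take Π₁ = {p ∨ q ← not ¬p, not ¬q} and let Π₂ add the constraint ← ¬p, ¬q.  The
-- empty guess gives Π₁ the candidate world view {∅}, which Π₂ lacks.  But the full guess
-- gives both programs the world view {{p},{q}}, and whenever p ∨ q is forced (by a
-- non-empty set of facts, or by the full guess) the constraint is blocked in every
-- reduct, so the two programs then have the same answer sets.
module Submission where

open import Defs
open import Data.Bool using (true; false; not)
open import Data.Empty using (⊥-elim)
open import Data.List using (List; []; _∷_; _++_; map)
open import Data.List.Properties using (map-++)
open import Data.List.Relation.Unary.All using (All; []; _∷_)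
import Data.List.Relation.Unary.All as All
import Data.List.Relation.Unary.All.Properties as Allₚ
open import Data.List.Relation.Unary.Any using (Any; here; there; satisfied)
open import Data.List.Membership.Propositional using (_∈_)
open import Data.Product using (Σ; _×_; _,_; proj₁; proj₂; ∃)
import Data.Product as Product
open import Data.Sum using (_⊎_; inj₁; inj₂)
open import Function.Base using (_∘_)
open import Function.Bundles using (_⇔_; mk⇔; Equivalence)
import Function.Properties.Equivalence as ⇔
open import Relation.Nullary using (¬_)
open import Relation.Binary.PropositionalEquality
  using (_≡_; _≢_; refl; sym; trans; cong; subst; _≗_)

open Equivalence using (to; from)

true≢false : true ≢ false
true≢false ()

module _ {A : Set} where

  Blocked : Interp A → LRule A → Set
  Blocked I r = Any (λ ℓ → ⟦ ℓ ⟧ⁿ I ≡ true) (bodyNeg r)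

  allFalse-blocked : {I : Interp A} (ℓs : List (NLit A))
    → Any (λ ℓ → ⟦ ℓ ⟧ⁿ I ≡ true) ℓs → allFalse I ℓs ≡ false
  allFalse-blocked (ℓ ∷ ℓs) (here ℓ-true) rewrite ℓ-true = refl
  allFalse-blocked {I} (ℓ ∷ ℓs) (there blocked) with ⟦ ℓ ⟧ⁿ I
  ... | true  = refl
  ... | false = allFalse-blocked ℓs blocked

  GL-blocked : {I : Interp A} {r : LRule A} (P : LP A) → Blocked I r → GL (r ∷ P) I ≡ GL P I
  GL-blocked {r = r} P blocked rewrite allFalse-blocked (bodyNeg r) blocked = refl

  ⊨ʳ-blocked : {I : Interp A} {r : LRule A} → Blocked I r → I ⊨ʳ r
  ⊨ʳ-blocked blocked (_ , negSat) = ⊥-elim (unsatisfiable blocked negSat)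
    where
    unsatisfiable : ∀ {I : Interp A} {ℓs}
      → Any (λ ℓ → ⟦ ℓ ⟧ⁿ I ≡ true) ℓs → ¬ All (SatNeg I) ℓs
    unsatisfiable (here ℓ-true) (ℓ-false ∷ _) = true≢false (trans (sym ℓ-true) ℓ-false)
    unsatisfiable (there blocked) (_ ∷ negSat) = unsatisfiable blocked negSat

  -- Such a rule holds in, and vanishes from the GL-reduct at, every model of P.
  answerSet-∷-blocked : {r : LRule A} (P : LP A) → (∀ I → I ⊨ᴾ P → Blocked I r)
    → ∀ I → AnswerSet (r ∷ P) I ⇔ AnswerSet P I
  answerSet-∷-blocked {r} P blockedInModels I = mk⇔
    (λ { (_ ∷ I⊨P , minimal) →
          I⊨P , λ M′ M′⊊I M′⊨GL → minimal M′ M′⊊I (subst (M′ ⊨ᴾ_) (sym (GL≡ I⊨P)) M′⊨GL) })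
    (λ { (I⊨P , minimal) →
          ⊨ʳ-blocked (blockedInModels I I⊨P) ∷ I⊨P ,
          λ M′ M′⊊I M′⊨GL → minimal M′ M′⊊I (subst (M′ ⊨ᴾ_) (GL≡ I⊨P) M′⊨GL) })
    where
    GL≡ : I ⊨ᴾ P → GL (r ∷ P) I ≡ GL P I
    GL≡ I⊨P = GL-blocked {r = r} P (blockedInModels I I⊨P)

  answerSet-of-empty-GL : {P : LP A} {M : Interp A} → GL P M ≡ [] → AnswerSet P M
    → ∀ a → M a ≡ false
  answerSet-of-empty-GL {M = M} GL≡[] (_ , minimal) a with M a in Ma
  ... | false = refl
  ... | true  = ⊥-elim (minimal (λ _ → false) ((λ _ ()) , a , Ma , refl)
                                (subst (_ ⊨ᴾ_) (sym GL≡[]) []))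

  answerSet-disjunctiveFact : (H : List A) (I : Interp A)
    → Any (True I) H → (∀ a b → I a ≡ true → I b ≡ true → a ≡ b)
    → AnswerSet (lrule H [] [] ∷ []) I
  answerSet-disjunctiveFact H I I∩H atMostOne =
    (λ _ → I∩H) ∷ [] , λ { M′ (M′⊆I , a , Ia , M′a) (M′⊨H ∷ []) →
      let b , M′b = satisfied (M′⊨H ([] , []))
      in true≢false (trans (sym (subst (λ x → M′ x ≡ true)
                                        (atMostOne b a (M′⊆I b M′b) Ia) M′b)) M′a) }

  facts-hold : {Π : ELP A} {Φ : Guess A} {I : Interp A} (D : List A)
    → I ⊨ᴾ epReduct (Π ∪ᶠ D) Φ → All (True I) D
  facts-hold {Π} {Φ} D I⊨reduct =
    All.map (λ I⊨fact → fact-head (I⊨fact ([] , [])))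
      (Allₚ.map⁻ (Allₚ.map⁻ (Allₚ.++⁻ʳ (map (reductRule Φ) (rules Π))
        (subst (All _) (map-++ (reductRule Φ) (rules Π) (map fact D)) I⊨reduct))))
    where
    fact-head : ∀ {I : Interp A} {a} → Any (True I) (a ∷ []) → I a ≡ true
    fact-head (here Ia) = Ia

  FullOn : List (EpLit A) → Guess A → Set
  FullOn ℰ Φ = ∀ ξ → ξ ∈ ℰ → Φ ξ ≡ true

  epiPart-full : {Φ : Guess A} (ξs : List (EpLit A)) → FullOn ξs Φ → epiPart Φ ξs ≡ []
  epiPart-full [] _ = refl
  epiPart-full {Φ} (ξ ∷ ξs) full rewrite full ξ (here refl) =
    epiPart-full ξs (λ ζ ζ∈ξs → full ζ (there ζ∈ξs))

  compatible-guess-unique : {ℰ : List (EpLit A)} {Φ Ψ : Guess A} {𝓜 : ISet A}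
    → (∀ ξ → Φ ξ ≡ true → ξ ∈ ℰ) → (∀ ξ → Ψ ξ ≡ true → ξ ∈ ℰ)
    → Compatible ℰ Φ 𝓜 → Compatible ℰ Ψ 𝓜 → Φ ≗ Ψ
  compatible-guess-unique {Φ = Φ} {Ψ} inΦ inΨ (_ , someΦ , allΦ) (_ , someΨ , allΨ) ξ
    with Φ ξ in eΦ | Ψ ξ in eΨ
  ... | true  | true  = refl
  ... | false | false = refl
  ... | true  | false =
    let I , I∈𝓜 , I⊭ξ = someΦ ξ (inΦ ξ eΦ) eΦ
    in ⊥-elim (true≢false (trans (sym (allΨ ξ (inΦ ξ eΦ) eΨ I I∈𝓜)) I⊭ξ))
  ... | false | true  =
    let I , I∈𝓜 , I⊭ξ = someΨ ξ (inΨ ξ eΨ) eΨ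
    in ⊥-elim (true≢false (trans (sym (allΦ ξ (inΨ ξ eΨ) eΦ I I∈𝓜)) I⊭ξ))

  CWVwith-guess-unique : {ℰ : List (EpLit A)} {Ra Rb : List (ERule A)} {Φ Ψ : Guess A} {𝓜 : ISet A}
    → CWVwith (elp ℰ Ra) Φ 𝓜 → CWVwith (elp ℰ Rb) Ψ 𝓜 → Φ ≗ Ψ
  CWVwith-guess-unique (inΦ , _ , cΦ) (inΨ , _ , cΨ) = compatible-guess-unique inΦ inΨ cΦ cΨ

  ⊊ᴳ-resp-≗ : {Φ Φ′ Ψ Ψ′ : Guess A} → Φ ≗ Φ′ → Ψ ≗ Ψ′ → Φ ⊊ᴳ Ψ → Φ′ ⊊ᴳ Ψ′
  ⊊ᴳ-resp-≗ Φ≗Φ′ Ψ≗Ψ′ (Φ⊆Ψ , ξ , Ψξ , ¬Φξ) =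
    (λ ζ Φ′ζ → trans (sym (Ψ≗Ψ′ ζ)) (Φ⊆Ψ ζ (trans (Φ≗Φ′ ζ) Φ′ζ))) ,
    ξ , trans (sym (Ψ≗Ψ′ ξ)) Ψξ , trans (sym (Φ≗Φ′ ξ)) ¬Φξ

  WV-transfer : {ℰ : List (EpLit A)} {Ra Rb : List (ERule A)}
    → CWVEquiv (elp ℰ Ra) (elp ℰ Rb) → ∀ 𝓜 → WV (elp ℰ Ra) 𝓜 → WV (elp ℰ Rb) 𝓜
  WV-transfer equiv 𝓜 (Φ , cwv₁ , maximal₁) =
    let Φ₂ , cwv₂ = proj₁ (equiv 𝓜) (Φ , cwv₁) in
    Φ₂ , cwv₂ , λ Ψ 𝓜′ cwv′₂ Φ₂⊊Ψ →
      let Ψ₂ , cwv′₁ = proj₂ (equiv 𝓜′) (Ψ , cwv′₂) in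
      maximal₁ Ψ₂ 𝓜′ cwv′₁
        (⊊ᴳ-resp-≗ (λ ξ → sym (CWVwith-guess-unique cwv₁ cwv₂ ξ))
                   (CWVwith-guess-unique cwv′₂ cwv′₁) Φ₂⊊Ψ)

  CWVEquiv⇒WVEquiv : {ℰ : List (EpLit A)} {Ra Rb : List (ERule A)}
    → CWVEquiv (elp ℰ Ra) (elp ℰ Rb) → WVEquiv (elp ℰ Ra) (elp ℰ Rb)
  CWVEquiv⇒WVEquiv equiv 𝓜 =
    WV-transfer equiv 𝓜 , WV-transfer (λ 𝓜′ → Product.swap (equiv 𝓜′)) 𝓜

  CWVwith-transport : {ℰ : List (EpLit A)} {Ra Rb : List (ERule A)} {Φ : Guess A}
    → (∀ I → AnswerSet (epReduct (elp ℰ Ra) Φ) I ⇔ AnswerSet (epReduct (elp ℰ Rb) Φ) I)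
    → ∀ 𝓜 → CWVwith (elp ℰ Ra) Φ 𝓜 → CWVwith (elp ℰ Rb) Φ 𝓜
  CWVwith-transport sameAS 𝓜 (inℰ , 𝓜≡AS , compatible) =
    inℰ , (λ I → (to (sameAS I) ∘ proj₁ (𝓜≡AS I)) , (proj₂ (𝓜≡AS I) ∘ from (sameAS I))) ,
    compatible

  full-guess-maximal : {Π : ELP A} {Φ Ψ : Guess A} {𝓜 : ISet A}
    → FullOn (eps Π) Φ → CWVwith Π Ψ 𝓜 → ¬ (Φ ⊊ᴳ Ψ)
  full-guess-maximal full (inℰ , _) (_ , ξ , Ψξ , ¬Φξ) =
    true≢false (trans (sym (full ξ (inℰ ξ Ψξ))) ¬Φξ)

  maximal-guess-full : {Π : ELP A} {Φ Ψ : Guess A} {𝓜 : ISet A}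
    → FullOn (eps Π) Ψ → CWVwith Π Ψ 𝓜
    → GuessIn Π Φ → (∀ Φ′ 𝓜′ → CWVwith Π Φ′ 𝓜′ → ¬ (Φ ⊊ᴳ Φ′))
    → FullOn (eps Π) Φ
  maximal-guess-full {Φ = Φ} {Ψ} {𝓜} fullΨ cwvΨ inℰ maximal ξ ξ∈ℰ with Φ ξ in Φξ
  ... | true  = refl
  ... | false = ⊥-elim (maximal Ψ 𝓜 cwvΨ ((λ ζ Φζ → fullΨ ζ (inℰ ζ Φζ)) , ξ , fullΨ ξ ξ∈ℰ , Φξ))

  -- Once some candidate world view has the full guess, world views are exactly the
  -- candidate world views with a full guess.
  WV-transfer-full : {ℰ : List (EpLit A)} {Ra Rb : List (ERule A)} {Ψ : Guess A} {𝓜′ : ISet A}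
    → FullOn ℰ Ψ → CWVwith (elp ℰ Ra) Ψ 𝓜′
    → (∀ Φ 𝓜 → FullOn ℰ Φ → CWVwith (elp ℰ Ra) Φ 𝓜 → CWVwith (elp ℰ Rb) Φ 𝓜)
    → ∀ 𝓜 → WV (elp ℰ Ra) 𝓜 → WV (elp ℰ Rb) 𝓜
  WV-transfer-full fullΨ cwvΨ transfer 𝓜 (Φ , cwv , maximal) =
    Φ , transfer Φ 𝓜 fullΦ cwv , λ _ _ → full-guess-maximal fullΦ
    where
    fullΦ : FullOn _ Φ
    fullΦ = maximal-guess-full fullΨ cwvΨ (proj₁ cwv) maximal

module Counterexample where

  data Atom : Set where
    p q : Atom

  ℰ : List (EpLit Atom)
  ℰ = neg p ∷ neg q ∷ []

  choice : ERule Atom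
  choice = erule (p ∷ q ∷ []) [] ℰ []

  constraint : ERule Atom
  constraint = erule [] (neg p ∷ neg q ∷ []) [] []

  Π₁ Π₂ : ELP Atom
  Π₁ = elp ℰ (choice ∷ [])
  Π₂ = elp ℰ (constraint ∷ choice ∷ [])

  wellFormed₁ : WellFormed Π₁
  wellFormed₁ = (here refl ∷ there (here refl) ∷ [] , []) ∷ []

  wellFormed₂ : WellFormed Π₂
  wellFormed₂ = ([] , []) ∷ wellFormed₁

  p∨q : Interp Atom → Set
  p∨q I = Any (True I) (p ∷ q ∷ [])

  Forces-p∨q : List Atom → Guess Atom → Set
  Forces-p∨q D Φ = ∀ I → I ⊨ᴾ epReduct (Π₁ ∪ᶠ D) Φ → p∨q I

  constraint-blocked : {Φ : Guess Atom} {I : Interp Atom} → p∨q I → Blocked I (reductRule Φ constraint)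
  constraint-blocked (here Ip) = here Ip
  constraint-blocked (there (here Iq)) = there (here Iq)

  sameCWVs : ∀ D Φ → Forces-p∨q D Φ → ∀ 𝓜 → CWVwith (Π₁ ∪ᶠ D) Φ 𝓜 ⇔ CWVwith (Π₂ ∪ᶠ D) Φ 𝓜
  sameCWVs D Φ forced 𝓜 =
    mk⇔ (CWVwith-transport {Ra = rules (Π₁ ∪ᶠ D)} {rules (Π₂ ∪ᶠ D)}
                           (λ I → ⇔.sym (sameAnswerSets I)) 𝓜)
        (CWVwith-transport {Ra = rules (Π₂ ∪ᶠ D)} {rules (Π₁ ∪ᶠ D)} sameAnswerSets 𝓜)
    where
    -- The reduct of Π₂ ∪ D is that of Π₁ ∪ D with the reduct of the constraint in front.
    sameAnswerSets : ∀ I → AnswerSet (epReduct (Π₂ ∪ᶠ D) Φ) I ⇔ AnswerSet (epReduct (Π₁ ∪ᶠ D) Φ) I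
    sameAnswerSets =
      answerSet-∷-blocked {r = reductRule Φ constraint} _ (λ I → constraint-blocked {Φ} ∘ forced I)

  facts-force-p∨q : ∀ d D Φ → Forces-p∨q (d ∷ D) Φ
  facts-force-p∨q d D Φ I I⊨reduct with d | facts-hold {Π = Π₁} (d ∷ D) I⊨reduct
  ... | p | Ip ∷ _ = here Ip
  ... | q | Iq ∷ _ = there (here Iq)

  fullGuess-forces-p∨q : ∀ D Φ → FullOn ℰ Φ → Forces-p∨q D Φ
  fullGuess-forces-p∨q D Φ full I (I⊨choice ∷ _) =
    I⊨choice ([] , subst (λ ℓs → All (SatNeg I) (ℓs ++ [])) (sym (epiPart-full ℰ full)) [])

  only : Atom → Interp Atom
  only p p = true
  only q q = true
  only _ _ = false

  only-unique : ∀ x a b → only x a ≡ true → only x b ≡ true → a ≡ b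
  only-unique p p p _ _ = refl
  only-unique p p q _ ()
  only-unique p q _ () _
  only-unique q q q _ _ = refl
  only-unique q q p _ ()
  only-unique q p _ () _

  fullGuess : Guess Atom
  fullGuess (neg _) = true
  fullGuess (pos _) = false

  fullGuess-full : FullOn ℰ fullGuess
  fullGuess-full _ (here refl) = refl
  fullGuess-full _ (there (here refl)) = refl

  fullView : ISet Atom
  fullView = AnswerSet (epReduct (Π₁ ∪ᶠ []) fullGuess)

  only-answerSet : ∀ x → fullView (only x)
  only-answerSet x = answerSet-disjunctiveFact (p ∷ q ∷ []) (only x) (x∈p∨q x) (only-unique x)
    where
    x∈p∨q : ∀ x → p∨q (only x)
    x∈p∨q p = here refl
    x∈p∨q q = there (here refl)

  fullCWV : CWVwith (Π₁ ∪ᶠ []) fullGuess fullView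
  fullCWV = inℰ , (λ I → (λ M → M) , (λ M → M)) , (only p , only-answerSet p) , falsified ,
            λ ξ ξ∈ℰ ¬fullξ → ⊥-elim (true≢false (trans (sym (fullGuess-full ξ ξ∈ℰ)) ¬fullξ))
    where
    inℰ : GuessIn (Π₁ ∪ᶠ []) fullGuess
    inℰ (neg p) _ = here refl
    inℰ (neg q) _ = there (here refl)

    falsified : ∀ ξ → ξ ∈ ℰ → fullGuess ξ ≡ true → ∃ λ I → fullView I × ⟦ ξ ⟧ˡ I ≡ false
    falsified _ (here refl) _ = only p , only-answerSet p , refl
    falsified _ (there (here refl)) _ = only q , only-answerSet q , refl

  emptyGuess : Guess Atom
  emptyGuess _ = false

  emptyReduct : LP Atom
  emptyReduct = epReduct (Π₁ ∪ᶠ []) emptyGuess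

  GL-emptyReduct-fires : {M : Interp Atom} → M p ≡ true → M q ≡ true
    → GL emptyReduct M ≡ lrule (p ∷ q ∷ []) [] [] ∷ []
  GL-emptyReduct-fires Mp Mq rewrite Mp | Mq = refl

  GL-emptyReduct-cases : ∀ M → GL emptyReduct M ≡ [] ⊎ (M p ≡ true × M q ≡ true)
  GL-emptyReduct-cases M with M p | M q
  ... | false | _     = inj₁ refl
  ... | true  | false = inj₁ refl
  ... | true  | true  = inj₂ (refl , refl)

  emptyReduct-answerSet-empty : ∀ M → AnswerSet emptyReduct M → ∀ a → M a ≡ false
  emptyReduct-answerSet-empty M M-answerSet@(_ , minimal) with GL-emptyReduct-cases M
  ... | inj₁ GL≡[] = answerSet-of-empty-GL {P = emptyReduct} GL≡[] M-answerSet
  ... | inj₂ (Mp , Mq) = ⊥-elim (minimal (only p) only-p⊊M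
      (subst (only p ⊨ᴾ_) (sym (GL-emptyReduct-fires {M} Mp Mq)) ((λ _ → here refl) ∷ [])))
    where
    only-p⊊M : only p ⊊ᴵ M
    only-p⊊M = (λ a only-p-a → subst (λ x → M x ≡ true) (only-unique p p a refl only-p-a) Mp) ,
               q , Mq , refl

  ∅ : Interp Atom
  ∅ _ = false

  ∅-answerSet : AnswerSet emptyReduct ∅
  ∅-answerSet = (λ { (_ , () ∷ _) }) ∷ [] , λ { _ (_ , _ , () , _) _ }

  emptyCWV : CWVwith (Π₁ ∪ᶠ []) emptyGuess (AnswerSet emptyReduct)
  emptyCWV = (λ _ ()) , (λ I → (λ M → M) , (λ M → M)) , (∅ , ∅-answerSet) , (λ _ _ ()) ,
             satisfied-by-all
    where
    satisfied-by-all : ∀ ξ → ξ ∈ ℰ → emptyGuess ξ ≡ false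
      → ∀ M → AnswerSet emptyReduct M → ⟦ ξ ⟧ˡ M ≡ true
    satisfied-by-all _ (here refl) _ M M-answerSet =
      cong not (emptyReduct-answerSet-empty M M-answerSet p)
    satisfied-by-all _ (there (here refl)) _ M M-answerSet =
      cong not (emptyReduct-answerSet-empty M M-answerSet q)

  -- ∅ violates the reduct of the constraint under every guess.
  emptyView-not-CWV₂ : ¬ CWV (Π₂ ∪ᶠ []) (AnswerSet emptyReduct)
  emptyView-not-CWV₂ (_ , _ , view≡AS , _) with proj₁ (view≡AS ∅) ∅-answerSet
  ... | ∅⊨constraint ∷ _ , _ with ∅⊨constraint ([] , refl ∷ refl ∷ [])
  ... | ()

  uniformWV : UniformWVEquiv Π₁ Π₂
  uniformWV [] 𝓜 =
    WV-transfer-full {Ra = rules (Π₁ ∪ᶠ [])} {rules (Π₂ ∪ᶠ [])} fullGuess-full fullCWV to₂ 𝓜 ,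
    WV-transfer-full {Ra = rules (Π₂ ∪ᶠ [])} {rules (Π₁ ∪ᶠ [])} fullGuess-full
                     (to₂ fullGuess fullView fullGuess-full fullCWV) to₁ 𝓜
    where
    to₂ : ∀ Φ 𝓜 → FullOn ℰ Φ → CWVwith (Π₁ ∪ᶠ []) Φ 𝓜 → CWVwith (Π₂ ∪ᶠ []) Φ 𝓜
    to₂ Φ 𝓜 full = to (sameCWVs [] Φ (fullGuess-forces-p∨q [] Φ full) 𝓜)
    to₁ : ∀ Φ 𝓜 → FullOn ℰ Φ → CWVwith (Π₂ ∪ᶠ []) Φ 𝓜 → CWVwith (Π₁ ∪ᶠ []) Φ 𝓜
    to₁ Φ 𝓜 full = from (sameCWVs [] Φ (fullGuess-forces-p∨q [] Φ full) 𝓜)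
  uniformWV (d ∷ D) =
    CWVEquiv⇒WVEquiv {Ra = rules (Π₁ ∪ᶠ (d ∷ D))} {rules (Π₂ ∪ᶠ (d ∷ D))} λ 𝓜 →
    Product.map₂ (λ {Φ} → to (same Φ 𝓜)) , Product.map₂ (λ {Φ} → from (same Φ 𝓜))
    where
    same : ∀ Φ 𝓜 → CWVwith (Π₁ ∪ᶠ (d ∷ D)) Φ 𝓜 ⇔ CWVwith (Π₂ ∪ᶠ (d ∷ D)) Φ 𝓜
    same Φ = sameCWVs (d ∷ D) Φ (facts-force-p∨q d D Φ)

  not-uniformCWV : ¬ UniformCWVEquiv Π₁ Π₂
  not-uniformCWV equiv =
    emptyView-not-CWV₂ (proj₁ (equiv [] (AnswerSet emptyReduct)) (emptyGuess , emptyCWV))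

open Counterexample using (Atom; Π₁; Π₂; wellFormed₁; wellFormed₂; uniformWV; not-uniformCWV)

proposition1 :
    ((A : Set) (ℰ : List (EpLit A)) (ℛ₁ ℛ₂ : List (ERule A))
      → WellFormed (elp ℰ ℛ₁) → WellFormed (elp ℰ ℛ₂)
      → UniformCWVEquiv (elp ℰ ℛ₁) (elp ℰ ℛ₂)
      → UniformWVEquiv (elp ℰ ℛ₁) (elp ℰ ℛ₂))
    × Σ Set (λ A → Σ (ELP A) (λ Π₁ → Σ (ELP A) (λ Π₂ →
        WellFormed Π₁ × WellFormed Π₂
        × UniformWVEquiv Π₁ Π₂
        × ¬ UniformCWVEquiv Π₁ Π₂)))
proposition1 =
  (λ _ _ _ _ _ _ uniformCWV D → CWVEquiv⇒WVEquiv (uniformCWV D)) ,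
  Atom , Π₁ , Π₂ , wellFormed₁ , wellFormed₂ , uniformWV , not-uniformCWV
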